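{- Let $G$ be a multiple wheel with principal path $\overrightarrow{v_kv_1v_2}$ none of whose components is an even wheel, where $v_3,\dots,v_{k-1}$ are the remaining vertices on the outer cycle of $G$ and $u_1,\dots,u_m$ are the vertices of $G$ not on the outer cycle. Then every monomial $v_1^0v_2^0v_k^0\prod_{i=3}^{k-1}v_i^{\alpha_i}\prod_{j=1}^m u_j^{\beta_j}$ with $\alpha_i\le2$ and $\beta_j\le4$ vanishes in $P(G-\overrightarrow{v_kv_1v_2})$.
   Context: For a graph $G$, vertices are also variables and $P(G)=\prod_{xy\in E(G),\,x<y}(x-y)$ for a fixed arbitrary orientation; a monomial vanishes if its coefficient is zero. $G-\overrightarrow{v_kv_1v_2}$ is $G$ with edges $v_kv_1,v_1v_2$ deleted (vertices kept). An ordinary wheel consists of a cycle $v_1\dots v_kv_1$ ($k\ge3$) and a vertex adjacent to all $v_i$; it is even if $k$ is even. A broken wheel consists of a path $v_2\dots v_k$ ($k\ge3$) and a vertex $v_1$ adjacent to all of $v_2,\dots,v_k$. For both, $\overrightarrow{v_kv_1v_2}$ is the principal path, $v_kv_1,v_1v_2$ the principal edges, $v_1,v_2,v_k$ the principal vertices. A double wheel is obtained from two graphs, each an ordinary or broken wheel, by identifying their vertices $v_1$ and identifying a principal edge of one with a principal edge of the other (the two pieces on opposite sides of the identified edge in the plane); iterating (gluing further ordinary or broken wheels along a principal edge at $v_1$) gives multiple wheels, with at least one component an ordinary wheel. The glued ordinary/broken wheels are the components; the common vertex is $v_1$, the two never-identified principal vertices are $v_2,v_k$, and $\overrightarrow{v_kv_1v_2}$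 is the principal path of the multiple wheel. -}

module Defs where

open import Data.Nat using (ℕ; zero; suc; _∸_; _≡ᵇ_)
open import Data.Nat.Divisibility using (_∣_)
open import Data.Integer using (ℤ; 0ℤ; 1ℤ; _-_)
open import Data.Bool using (Bool; true; false; if_then_else_; not; _∨_; _∧_)
open import Data.List using (List; []; _∷_; _++_; map; applyUpTo; filterᵇ; length)
open import Data.Bool.ListAction using (any; all)
open import Data.Product using (_×_; _,_)
open import Data.Empty using (⊥)
open import Data.Unit using (⊤)
open import Relation.Nullary using (yes; no; Dec; does)
open import Relation.Binary.PropositionalEquality using (_≡_; refl; cong; cong₂)
open import Relation.Binary.Definitions using (DecidableEquality)
import Data.Nat as N

-- A graph is given by a list of vertices and a list of oriented edges
-- (x , y), standing for the factor (x - y) of P(G) = ∏ (x - y).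
-- `coeff vs es α` is the coefficient of the monomial ∏_{v ∈ vs} v^(α v)
-- in ∏_{(x,y) ∈ es} (x - y), computed by the product rule
--   [x^α] ((x - y) · Q) = [x^(α - e_x)] Q - [x^(α - e_y)] Q .

module Poly {V : Set} (_≟_ : DecidableEquality V) where

  update : (V → ℕ) → V → ℕ → (V → ℕ)
  update α x n v = if does (v ≟ x) then n else α v

  coeff : List V → List (V × V) → (V → ℕ) → ℤ
  coeff vs [] α = if all (λ v → α v ≡ᵇ 0) vs then 1ℤ else 0ℤ
  coeff vs ((x , y) ∷ es) α = pick x (α x) - pick y (α y)
    where
    pick : V → ℕ → ℤ
    pick z zero    = 0ℤ
    pick z (suc n) = coeff vs es (update α z n)

  Vanishes : List V → List (V × V) → (V → ℕ) → Set
  Vanishes vs es α = coeff vs es α ≡ 0ℤ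

  sameEdge : V × V → V × V → Bool
  sameEdge (a , b) (c , d) =
    (does (a ≟ c) ∧ does (b ≟ d)) ∨ (does (a ≟ d) ∧ does (b ≟ c))

  deleteEdges : List (V × V) → List (V × V) → List (V × V)
  deleteEdges ps es = filterᵇ (λ e → not (any (sameEdge e) ps)) es

-- A component is an ordinary wheel or a broken wheel with parameter k
-- (ordinary: rim cycle v1 … vk plus a centre; broken: path v2 … vk plus
-- hub v1).  A multiple wheel with components c_0, …, c_{t-1} is a chain:
-- component i has principal vertices  spoke i  (its v_k) and
-- spoke (i+1)  (its v_2); consecutive components share the principal
-- edge  hub — spoke (i+1).  The common vertex v1 is `hub`.  The
-- principal path of the multiple wheel is  spoke 0 — hub — spoke t.

data Kind : Set where
  ordinary broken : Kind

record Comp : Set where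
  constructor comp
  field
    kind : Kind
    size : ℕ        -- the parameter k ≥ 3
open Comp public

data Vert : Set where
  hub    : Vert
  spoke  : ℕ → Vert
  inner  : ℕ → ℕ → Vert       -- inner i j : j-th internal path vertex of component i
  center : ℕ → Vert

_≟V_ : DecidableEquality Vert
hub ≟V hub = yes refl
hub ≟V spoke _ = no λ ()
hub ≟V inner _ _ = no λ ()
hub ≟V center _ = no λ ()
spoke _ ≟V hub = no λ ()
spoke m ≟V spoke n with m N.≟ n
... | yes refl = yes refl
... | no ne = no λ { refl → ne refl }
spoke _ ≟V inner _ _ = no λ ()
spoke _ ≟V center _ = no λ ()
inner _ _ ≟V hub = no λ ()
inner _ _ ≟V spoke _ = no λ ()
inner a b ≟V inner c d with a N.≟ c | b N.≟ d
... | yes refl | yes refl = yes refl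
... | no ne | _ = no λ { refl → ne refl }
... | yes _ | no ne = no λ { refl → ne refl }
inner _ _ ≟V center _ = no λ ()
center _ ≟V hub = no λ ()
center _ ≟V spoke _ = no λ ()
center _ ≟V inner _ _ = no λ ()
center m ≟V center n with m N.≟ n
... | yes refl = yes refl
... | no ne = no λ { refl → ne refl }

open Poly _≟V_ public

-- internal path vertices v3 … v_{k-1} of component i
internalVerts : ℕ → Comp → List Vert
internalVerts i c = applyUpTo (λ j → inner i (suc j)) (size c ∸ 3)

pathVerts : ℕ → Comp → List Vert
pathVerts i c = spoke (suc i) ∷ internalVerts i c ++ spoke i ∷ []

consecutive : List Vert → List (Vert × Vert)
consecutive (x ∷ y ∷ r) = (x , y) ∷ consecutive (y ∷ r)
consecutive _ = []

-- edges of component i other than the two principal edges hub—spoke i,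
-- hub—spoke (i+1) (those are added once, globally)
compEdges : ℕ → Comp → List (Vert × Vert)
compEdges i (comp ordinary k) =
  consecutive (pathVerts i (comp ordinary k))
  ++ (center i , hub) ∷ map (λ v → (center i , v)) (pathVerts i (comp ordinary k))
compEdges i (comp broken k) =
  consecutive (pathVerts i (comp broken k))
  ++ map (λ v → (hub , v)) (internalVerts i (comp broken k))

compExtraVerts : ℕ → Comp → List Vert
compExtraVerts i (comp ordinary k) = center i ∷ internalVerts i (comp ordinary k)
compExtraVerts i (comp broken k)   = internalVerts i (comp broken k)

allCompEdges : ℕ → List Comp → List (Vert × Vert)
allCompEdges i [] = []
allCompEdges i (c ∷ cs) = compEdges i c ++ allCompEdges (suc i) cs

allInternal : ℕ → List Comp → List Vert
allInternal i [] = []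
allInternal i (c ∷ cs) = internalVerts i c ++ allInternal (suc i) cs

allCenters : ℕ → List Comp → List Vert
allCenters i [] = []
allCenters i (comp ordinary k ∷ cs) = center i ∷ allCenters (suc i) cs
allCenters i (comp broken k ∷ cs) = allCenters (suc i) cs

mwVertices : List Comp → List Vert
mwVertices cs =
  hub ∷ applyUpTo spoke (suc (length cs)) ++ allInternal 0 cs ++ allCenters 0 cs

mwEdges : List Comp → List (Vert × Vert)
mwEdges cs = applyUpTo (λ j → (hub , spoke j)) (suc (length cs)) ++ allCompEdges 0 cs

principalV2 : List Comp → Vert
principalV2 cs = spoke (length cs)

principalVk : List Comp → Vert
principalVk cs = spoke 0

principalEdges : List Comp → List (Vert × Vert)
principalEdges cs = (principalVk cs , hub) ∷ (hub , principalV2 cs) ∷ []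

mwEdgesMinusPrincipal : List Comp → List (Vert × Vert)
mwEdgesMinusPrincipal cs = deleteEdges (principalEdges cs) (mwEdges cs)

-- v3, …, v_{k-1}: outer-cycle vertices other than v1, v2, vk
outerRest : List Comp → List Vert
outerRest cs = applyUpTo (λ j → spoke (suc j)) (length cs ∸ 1) ++ allInternal 0 cs

-- u1, …, um: vertices not on the outer cycle
innerVerts : List Comp → List Vert
innerVerts cs = allCenters 0 cs

IsOrdinary : Comp → Set
IsOrdinary (comp ordinary _) = ⊤
IsOrdinary (comp broken _) = ⊥

IsEvenWheel : Comp → Set
IsEvenWheel (comp ordinary k) = 2 ∣ k
IsEvenWheel (comp broken _) = ⊥

module Submission where

-- Expanding ∏ (x − y) factor by factor, each factor contributes one of its endpoints, and the
-- coefficient of x^α is the signed count of the contributions that use up α exactly.  Since v₁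
-- has exponent 0, each interior spoke v₁v_j lowers v_j, which leaves the spokes of G a total
-- exponent smaller than the number of components.  Treating the components one after another,
-- lowering a principal spoke of the current component would starve the remaining ones, so both
-- its principal spokes may be taken with exponent 0.  A broken wheel then has more edges than
-- exponent to absorb them; so has an ordinary wheel, except when every vertex is saturated.  In
-- that case α is symmetric under the reflection of the wheel, which for odd k reverses an odd
-- number k − 2 of rim edges, so the coefficient equals its own negative.

open import Defs
open import Data.Nat using (ℕ; _≤_)
open import Data.List using (List; length)
open import Data.List.Relation.Unary.All using (All)
open import Data.List.Relation.Unary.Any using (Any)
open import Data.List.Membership.Propositional using (_∈_)
open import Relation.Nullary using (¬_)
open import Relation.Binary.PropositionalEquality using (_≡_)

open import Data.Bool using (true; false; T; not; if_then_else_)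
open import Data.Bool.ListAction using (and; all; any)
open import Data.Empty using (⊥-elim)
open import Data.Integer using (ℤ; 0ℤ; 1ℤ; -1ℤ; _-_; -_)
import Data.Integer as ℤ
import Data.Integer.Properties as ℤ
open import Data.Integer.Solver using (module +-*-Solver)
open import Data.List using ([]; _∷_; _++_; _∷ʳ_; filter; map; reverse; applyUpTo; applyDownFrom)
open import Data.List.Membership.Propositional.Properties using (∈-++⁺ˡ; ∈-++⁺ʳ; ∈-applyUpTo⁺)
open import Data.List.Properties
  using (map-cong; map-++; map-∘; map-applyUpTo; length-++; length-map; length-applyUpTo;
         ++-identityʳ; unfold-reverse; reverse-++; reverse-applyUpTo; applyUpTo-∷ʳ;
         filter-++; filter-all; filter-reject)
open import Data.List.Relation.Binary.Permutation.Propositional using (_↭_; prep; swap)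
  renaming (refl to ↭-refl; trans to ↭-trans)
import Data.List.Relation.Binary.Permutation.Propositional.Properties as ↭
open import Data.List.Relation.Unary.All using ([]; _∷_)
import Data.List.Relation.Unary.All as All
import Data.List.Relation.Unary.All.Properties as All
open import Data.List.Relation.Unary.AllPairs using (_∷_)
open import Data.List.Relation.Unary.Any using (here; there)
open import Data.List.Relation.Unary.Unique.Propositional using (Unique)
import Data.List.Relation.Unary.Unique.Propositional.Properties as Unique
open import Data.Nat using (zero; suc; _+_; _*_; _∸_; _<_; _≡ᵇ_; z≤n; s≤s)
open import Data.Nat.Divisibility using (_∣_; divides)
open import Data.Nat.ListAction using (sum)
open import Data.Nat.ListAction.Properties using (sum-++)
open import Data.Nat.Properties using (_<?_)
import Data.Nat.Properties as ℕ
import Data.Nat.Solver as ℕ-Solver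
open import Data.Product using (_×_; _,_; ∃-syntax)
import Data.Product as Product
open import Data.Sum using (_⊎_; inj₁; inj₂)
open import Data.Unit using (tt)
open import Function using (_∘_; id)
open import Relation.Nullary using (yes; no)
open import Relation.Nullary.Decidable using (dec-true; dec-false; T?)
open import Relation.Binary.Definitions using (DecidableEquality)
open import Relation.Binary.PropositionalEquality
  using (_≢_; _≗_; refl; sym; trans; cong; cong₂; subst; subst₂; module ≡-Reasoning)

+-tight : ∀ {a b c d} → a ≤ c → b ≤ d → c + d ≤ a + b → a ≡ c × b ≡ d
+-tight {a} {b} {c} {d} a≤c b≤d c+d≤a+b =
  ℕ.≤-antisym a≤c (ℕ.+-cancelʳ-≤ b c a (ℕ.≤-trans (ℕ.+-monoʳ-≤ c b≤d) c+d≤a+b)) ,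
  ℕ.≤-antisym b≤d (ℕ.+-cancelˡ-≤ a d b (ℕ.≤-trans (ℕ.+-monoˡ-≤ d a≤c) c+d≤a+b))

∸-suc-< : ∀ {j m} → j < m → m ∸ suc j < m
∸-suc-< {j} {suc m} _ = s≤s (ℕ.m∸n≤m m j)

∸-suc-involutive : ∀ {j m} → j < m → m ∸ suc (m ∸ suc j) ≡ j
∸-suc-involutive {j} {suc m} (s≤s j≤m) = ℕ.m∸[m∸n]≡n j≤m

even-or-odd : ∀ m → (∃[ q ] m ≡ 2 * q) ⊎ (∃[ q ] m ≡ suc (2 * q))
even-or-odd zero = inj₁ (0 , refl)
even-or-odd (suc m) with even-or-odd m
... | inj₁ (q , m≡2q)   = inj₂ (q , cong suc m≡2q)
... | inj₂ (q , m≡1+2q) = inj₁ (suc q , cong suc (trans m≡1+2q (sym (ℕ.+-suc q (q + 0)))))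

-- For k = 1 this holds because of truncated subtraction.
odd⇒∸3-even : ∀ k → ¬ 2 ∣ k → ∃[ q ] k ∸ 3 ≡ 2 * q
odd⇒∸3-even k 2∤k with even-or-odd k
... | inj₁ (q , k≡2q) = ⊥-elim (2∤k (divides q (trans k≡2q (ℕ.*-comm 2 q))))
... | inj₂ (q , refl) = q ∸ 1 , sym (ℕ.*-distribˡ-∸ 2 q 1)

applyUpTo-cong : ∀ {A : Set} {f g : ℕ → A} n → (∀ {j} → j < n → f j ≡ g j)
  → applyUpTo f n ≡ applyUpTo g n
applyUpTo-cong zero    f≡g = refl
applyUpTo-cong (suc n) f≡g = cong₂ _∷_ (f≡g (s≤s z≤n)) (applyUpTo-cong n (f≡g ∘ s≤s))

applyUpTo-reflect : ∀ {A : Set} (f : ℕ → A) n → applyUpTo (λ j → f (n ∸ suc j)) n ≡ applyDownFrom f n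
applyUpTo-reflect f zero    = refl
applyUpTo-reflect f (suc n) = cong (f n ∷_) (applyUpTo-reflect f n)

module CoefficientCalculus {V : Set} (_≟_ : DecidableEquality V) where

  Exponent : Set
  Exponent = V → ℕ

  Edge : Set
  Edge = V × V

  infixl 30 _[_≔_]
  _[_≔_] : Exponent → V → ℕ → Exponent
  _[_≔_] = Poly.update _≟_

  infix 4 _≤ₑ_
  _≤ₑ_ : Exponent → Exponent → Set
  β ≤ₑ α = ∀ v → β v ≤ α v

  ≔-same : ∀ α x n → (α [ x ≔ n ]) x ≡ n
  ≔-same α x n rewrite dec-true (x ≟ x) refl = refl

  ≔-other : ∀ α {x} n {y} → y ≢ x → (α [ x ≔ n ]) y ≡ α y
  ≔-other α {x} n {y} y≢x rewrite dec-false (y ≟ x) y≢x = refl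

  ≔-cong : ∀ {α β} x n → α ≗ β → α [ x ≔ n ] ≗ β [ x ≔ n ]
  ≔-cong x n α≗β v with v ≟ x
  ... | yes _ = refl
  ... | no  _ = α≗β v

  ≔-comm : ∀ α {x y} n m → x ≢ y → α [ x ≔ n ] [ y ≔ m ] ≗ α [ y ≔ m ] [ x ≔ n ]
  ≔-comm α {x} {y} n m x≢y v with v ≟ x | v ≟ y
  ... | yes refl | yes refl = ⊥-elim (x≢y refl)
  ... | yes refl | no  _    = refl
  ... | no  _    | yes refl = refl
  ... | no  _    | no  _    = refl

  ≔-restore : ∀ α x n → α x ≡ n → α ≗ α [ x ≔ 0 ] [ x ≔ n ]
  ≔-restore α x n αx≡n v with v ≟ x
  ... | yes refl = αx≡n
  ... | no  _    = refl

  ≔-0-≤ : ∀ α x → α [ x ≔ 0 ] ≤ₑ α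
  ≔-0-≤ α x v with v ≟ x
  ... | yes _ = z≤n
  ... | no  _ = ℕ.≤-refl

  ≔-lowers : ∀ α x {n} → α x ≡ suc n → α [ x ≔ n ] ≤ₑ α
  ≔-lowers α x {n} αx≡1+n v with v ≟ x
  ... | yes refl = subst (n ≤_) (sym αx≡1+n) (ℕ.n≤1+n n)
  ... | no  _    = ℕ.≤-refl

  Congruent : (Exponent → ℤ) → Set
  Congruent F = ∀ {α β} → α ≗ β → F α ≡ F β

  -- The coefficient of x^α in ∏_{(x , y) ∈ es} (x − y) · Q, where Q is given by its
  -- coefficient function F.
  mutual
    coeffMul : List Edge → (Exponent → ℤ) → Exponent → ℤ
    coeffMul []             F α = F α
    coeffMul ((x , y) ∷ es) F α = lowerAt es F α x (α x) - lowerAt es F α y (α y)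

    lowerAt : List Edge → (Exponent → ℤ) → Exponent → V → ℕ → ℤ
    lowerAt es F α z zero    = 0ℤ
    lowerAt es F α z (suc n) = coeffMul es F (α [ z ≔ n ])

  peel : List Edge → (Exponent → ℤ) → Exponent → V → ℤ
  peel es F α z = lowerAt es F α z (α z)

  peel-≡ : ∀ es F α z {m} → α z ≡ m → peel es F α z ≡ lowerAt es F α z m
  peel-≡ es F α z refl = refl

  coeffMul-∷-cong : ∀ e {es es' F G} → (∀ α → coeffMul es F α ≡ coeffMul es' G α)
    → ∀ α → coeffMul (e ∷ es) F α ≡ coeffMul (e ∷ es') G α
  coeffMul-∷-cong (x , y) {es} {es'} {F} {G} h α = cong₂ _-_ (lower x) (lower y)
    where
    lower : ∀ z → peel es F α z ≡ peel es' G α z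
    lower z with α z
    ... | zero  = refl
    ... | suc n = h (α [ z ≔ n ])

  coeffMul-++ : ∀ A B F α → coeffMul (A ++ B) F α ≡ coeffMul A (coeffMul B F) α
  coeffMul-++ []      B F α = refl
  coeffMul-++ (e ∷ A) B F α = coeffMul-∷-cong e (coeffMul-++ A B F) α

  coeffMul-congruent : ∀ es {F} → Congruent F → Congruent (coeffMul es F)
  coeffMul-congruent []             F-cong α≗β = F-cong α≗β
  coeffMul-congruent ((x , y) ∷ es) {F} F-cong {α} {β} α≗β = cong₂ _-_ (lower x) (lower y)
    where
    lower : ∀ z → peel es F α z ≡ peel es F β z
    lower z rewrite α≗β z with β z
    ... | zero  = refl
    ... | suc n = coeffMul-congruent es F-cong (≔-cong z n α≗β)

  coeffOne : List V → Exponent → ℤ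
  coeffOne vs α = if all (λ v → α v ≡ᵇ 0) vs then 1ℤ else 0ℤ

  coeffOne-congruent : ∀ vs → Congruent (coeffOne vs)
  coeffOne-congruent vs α≗β =
    cong (λ b → if b then 1ℤ else 0ℤ) (cong and (map-cong (λ v → cong (_≡ᵇ 0) (α≗β v)) vs))

  coeff≡coeffMul : ∀ vs es α → Poly.coeff _≟_ vs es α ≡ coeffMul es (coeffOne vs) α
  coeff≡coeffMul vs []             α = refl
  coeff≡coeffMul vs ((x , y) ∷ es) α with α x | α y
  ... | zero  | zero  = refl
  ... | zero  | suc m = cong (λ z → 0ℤ - z) (coeff≡coeffMul vs es _)
  ... | suc n | zero  = cong (_- 0ℤ) (coeff≡coeffMul vs es _)
  ... | suc n | suc m = cong₂ _-_ (coeff≡coeffMul vs es _) (coeff≡coeffMul vs es _)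

  -- β is what is left of x^α once every factor (x − y) of es has contributed x or y:
  -- the coefficients of the cofactor that coeffMul es F α actually consults.
  data Reach : List Edge → Exponent → Exponent → Set where
    done  : ∀ {α} → Reach [] α α
    pickˡ : ∀ {x y es α β n} → α x ≡ suc n → Reach es (α [ x ≔ n ]) β → Reach ((x , y) ∷ es) α β
    pickʳ : ∀ {x y es α β n} → α y ≡ suc n → Reach es (α [ y ≔ n ]) β → Reach ((x , y) ∷ es) α β

  reach-≤ : ∀ {es α β} → Reach es α β → β ≤ₑ α
  reach-≤ done                  v = ℕ.≤-refl
  reach-≤ (pickˡ {α = α} αx r) v = ℕ.≤-trans (reach-≤ r v) (≔-lowers α _ αx v)
  reach-≤ (pickʳ {α = α} αy r) v = ℕ.≤-trans (reach-≤ r v) (≔-lowers α _ αy v)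

  coeffMul-cong-reach : ∀ es {F G} α → (∀ β → Reach es α β → F β ≡ G β)
    → coeffMul es F α ≡ coeffMul es G α
  coeffMul-cong-reach []             α h = h α done
  coeffMul-cong-reach ((x , y) ∷ es) {F} {G} α h =
    cong₂ _-_ (lower x (λ αx → pickˡ αx)) (lower y (λ αy → pickʳ αy))
    where
    lower : ∀ z → (∀ {n β} → α z ≡ suc n → Reach es (α [ z ≔ n ]) β → Reach ((x , y) ∷ es) α β)
      → peel es F α z ≡ peel es G α z
    lower z pick with α z
    ... | zero  = refl
    ... | suc n = coeffMul-cong-reach es _ (λ β r → h β (pick refl r))

  coeffMul-zero : ∀ es α → coeffMul es (λ _ → 0ℤ) α ≡ 0ℤ
  coeffMul-zero []             α = refl
  coeffMul-zero ((x , y) ∷ es) α = cong₂ _-_ (lower x (α x)) (lower y (α y))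
    where
    lower : ∀ z m → lowerAt es (λ _ → 0ℤ) α z m ≡ 0ℤ
    lower z zero    = refl
    lower z (suc n) = coeffMul-zero es (α [ z ≔ n ])

  coeffMul-vanishes : ∀ es {F} α → (∀ β → Reach es α β → F β ≡ 0ℤ) → coeffMul es F α ≡ 0ℤ
  coeffMul-vanishes es α h = trans (coeffMul-cong-reach es α h) (coeffMul-zero es α)

  coeffMul-swap : ∀ e₁ e₂ es {F} → Congruent F → ∀ α
    → coeffMul (e₁ ∷ e₂ ∷ es) F α ≡ coeffMul (e₂ ∷ e₁ ∷ es) F α
  coeffMul-swap (x₁ , y₁) (x₂ , y₂) es {F} F-cong α = begin
    peel e₂es F α x₁ - peel e₂es F α y₁
      ≡⟨ cong₂ _-_ (peel-twice x₂ y₂ x₁) (peel-twice x₂ y₂ y₁) ⟩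
    (twice x₁ x₂ - twice x₁ y₂) - (twice y₁ x₂ - twice y₁ y₂)
      ≡⟨ cong₂ _-_ (cong₂ _-_ (twice-sym x₁ x₂) (twice-sym x₁ y₂))
                   (cong₂ _-_ (twice-sym y₁ x₂) (twice-sym y₁ y₂)) ⟩
    (twice x₂ x₁ - twice y₂ x₁) - (twice x₂ y₁ - twice y₂ y₁)
      ≡⟨ exchange (twice x₂ x₁) (twice y₂ x₁) (twice x₂ y₁) (twice y₂ y₁) ⟩
    (twice x₂ x₁ - twice x₂ y₁) - (twice y₂ x₁ - twice y₂ y₁)
      ≡⟨ cong₂ _-_ (peel-twice x₁ y₁ x₂) (peel-twice x₁ y₁ y₂) ⟨
    peel e₁es F α x₂ - peel e₁es F α y₂ ∎
    where
    open ≡-Reasoning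
    e₁es = (x₁ , y₁) ∷ es
    e₂es = (x₂ , y₂) ∷ es

    twice : V → V → ℤ
    twice z w with α z
    ... | zero  = 0ℤ
    ... | suc n = peel es F (α [ z ≔ n ]) w

    peel-twice : ∀ x y z → peel ((x , y) ∷ es) F α z ≡ twice z x - twice z y
    peel-twice x y z with α z
    ... | zero  = refl
    ... | suc n = refl

    twice-sym : ∀ z w → twice z w ≡ twice w z
    twice-sym z w with z ≟ w
    ... | yes refl = refl
    ... | no z≢w with α z in αz | α w in αw
    ... | zero  | zero  = refl
    ... | zero  | suc m = sym (peel-≡ es F (α [ w ≔ m ]) z (trans (≔-other α m z≢w) αz))
    ... | suc n | zero  = peel-≡ es F (α [ z ≔ n ]) w (trans (≔-other α n (z≢w ∘ sym)) αw)
    ... | suc n | suc m = begin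
      peel es F (α [ z ≔ n ]) w
        ≡⟨ peel-≡ es F (α [ z ≔ n ]) w (trans (≔-other α n (z≢w ∘ sym)) αw) ⟩
      coeffMul es F (α [ z ≔ n ] [ w ≔ m ])
        ≡⟨ coeffMul-congruent es F-cong (≔-comm α n m z≢w) ⟩
      coeffMul es F (α [ w ≔ m ] [ z ≔ n ])
        ≡⟨ peel-≡ es F (α [ w ≔ m ]) z (trans (≔-other α m z≢w) αz) ⟨
      peel es F (α [ w ≔ m ]) z         ∎

    exchange : ∀ a b c d → (a - b) - (c - d) ≡ (a - c) - (b - d)
    exchange = solve 4 (λ a b c d → (a :- b) :- (c :- d) := (a :- c) :- (b :- d)) refl
      where open +-*-Solver

  coeffMul-↭ : ∀ {es es' F} → Congruent F → es ↭ es' → ∀ α → coeffMul es F α ≡ coeffMul es' F α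
  coeffMul-↭ F-cong ↭-refl            α = refl
  coeffMul-↭ F-cong (prep e p)        α = coeffMul-∷-cong e (coeffMul-↭ F-cong p) α
  coeffMul-↭ F-cong (swap e₁ e₂ p)    α = trans
    (coeffMul-∷-cong e₁ (coeffMul-∷-cong e₂ (coeffMul-↭ F-cong p)) α) (coeffMul-swap e₁ e₂ _ F-cong α)
  coeffMul-↭ F-cong (↭-trans p q)     α = trans (coeffMul-↭ F-cong p α) (coeffMul-↭ F-cong q α)

  coeffMul-reorient : ∀ Q R F α
    → coeffMul (map Product.swap Q ++ R) F α ≡ -1ℤ ℤ.^ length Q ℤ.* coeffMul (Q ++ R) F α
  coeffMul-reorient []             R F α = sym (ℤ.*-identityˡ _)
  coeffMul-reorient ((x , y) ∷ Q) R F α = begin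
    reversed y - reversed x                  ≡⟨ cong₂ _-_ (reversed≡ y) (reversed≡ x) ⟩
    s ℤ.* original y - s ℤ.* original x      ≡⟨ negate (original x) (original y) s ⟩
    (-1ℤ ℤ.* s) ℤ.* (original x - original y) ∎
    where
    open ≡-Reasoning
    s : ℤ
    s = -1ℤ ℤ.^ length Q

    reversed original : V → ℤ
    reversed = peel (map Product.swap Q ++ R) F α
    original = peel (Q ++ R) F α

    reversed≡ : ∀ z → reversed z ≡ s ℤ.* original z
    reversed≡ z with α z
    ... | zero  = sym (ℤ.*-zeroʳ s)
    ... | suc n = coeffMul-reorient Q R F (α [ z ≔ n ])

    negate : ∀ a b s → s ℤ.* b - s ℤ.* a ≡ (-1ℤ ℤ.* s) ℤ.* (a - b)
    negate = solve 3 (λ a b s → s :* b :- s :* a := (con -1ℤ :* s) :* (a :- b)) refl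
      where open +-*-Solver

  coeffMul-freeze : ∀ es {F} → Congruent F → ∀ α v a → α v ≡ a
    → (∀ β → β ≤ₑ α → β v < a → F β ≡ 0ℤ)
    → coeffMul es F α ≡ coeffMul es (λ β → F (β [ v ≔ a ])) (α [ v ≔ 0 ])
  coeffMul-freeze []             F-cong α v a αv _    = F-cong (≔-restore α v a αv)
  coeffMul-freeze ((x , y) ∷ es) {F} F-cong α v a αv kill = cong₂ _-_ (lower x) (lower y)
    where
    G : Exponent → ℤ
    G β = F (β [ v ≔ a ])

    lower : ∀ z → peel es F α z ≡ peel es G (α [ v ≔ 0 ]) z
    lower z with z ≟ v
    ... | yes refl = frozen (α z) refl
      where
      frozen : ∀ m → α z ≡ m → peel es F α z ≡ 0ℤ
      frozen zero    αz = peel-≡ es F α z αz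
      frozen (suc n) αz = trans (peel-≡ es F α z αz) (coeffMul-vanishes es _ λ β r →
        kill β (λ w → ℕ.≤-trans (reach-≤ r w) (≔-lowers α z αz w))
               (ℕ.<-≤-trans (s≤s (subst (β z ≤_) (≔-same α z n) (reach-≤ r z)))
                            (ℕ.≤-reflexive (trans (sym αz) αv))))
    ... | no z≢v with α z in αz
    ... | zero  = refl
    ... | suc n = trans
      (coeffMul-freeze es F-cong (α [ z ≔ n ]) v a (trans (≔-other α n (z≢v ∘ sym)) αv)
        (λ β β≤ → kill β (λ w → ℕ.≤-trans (β≤ w) (≔-lowers α z αz w))))
      (coeffMul-congruent es (λ β≗γ → F-cong (≔-cong v a β≗γ)) (≔-comm α n 0 z≢v))

  -- If lowering v or w kills the cofactor, their exponents are never lowered and may be frozen.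
  coeffMul-vanishes-frozen : ∀ es {F} → Congruent F → ∀ α {v w} → v ≢ w
    → (∀ β → β ≤ₑ α → β v < α v ⊎ β w < α w → F β ≡ 0ℤ)
    → (∀ {G} → Congruent G → coeffMul es G (α [ v ≔ 0 ] [ w ≔ 0 ]) ≡ 0ℤ)
    → coeffMul es F α ≡ 0ℤ
  coeffMul-vanishes-frozen es {F} F-cong α {v} {w} v≢w kill frozen-vanishes = begin
    coeffMul es F α    ≡⟨ coeffMul-freeze es F-cong α v (α v) refl (λ β β≤ lt → kill β β≤ (inj₁ lt)) ⟩
    coeffMul es F₁ α₁  ≡⟨ coeffMul-freeze es F₁-cong α₁ w (α₁ w) refl (λ β β≤ lt →
                            kill (β [ v ≔ α v ]) (restored β β≤) (inj₂ (lowered β lt))) ⟩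
    coeffMul es (λ β → F₁ (β [ w ≔ α₁ w ])) (α₁ [ w ≔ 0 ])
                       ≡⟨ frozen-vanishes (λ β≗γ → F₁-cong (≔-cong w (α₁ w) β≗γ)) ⟩
    0ℤ                 ∎
    where
    open ≡-Reasoning
    α₁ : Exponent
    α₁ = α [ v ≔ 0 ]

    F₁ : Exponent → ℤ
    F₁ β = F (β [ v ≔ α v ])

    F₁-cong : Congruent F₁
    F₁-cong β≗γ = F-cong (≔-cong v (α v) β≗γ)

    restored : ∀ β → β ≤ₑ α₁ → β [ v ≔ α v ] ≤ₑ α
    restored β β≤ u with u ≟ v
    ... | yes refl = ℕ.≤-refl
    ... | no  u≢v  = subst (β u ≤_) (≔-other α 0 u≢v) (β≤ u)

    lowered : ∀ β → β w < α₁ w → (β [ v ≔ α v ]) w < α w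
    lowered β lt = subst₂ _<_ (sym (≔-other β (α v) (v≢w ∘ sym))) (≔-other α 0 (v≢w ∘ sym)) lt

  module Renaming (σ : V → V) (σ-involutive : ∀ v → σ (σ v) ≡ v) where

    renameEdge : Edge → Edge
    renameEdge = Product.map σ σ

    ≔-rename : ∀ α x n → (α [ σ x ≔ n ]) ∘ σ ≗ (α ∘ σ) [ x ≔ n ]
    ≔-rename α x n v with v ≟ x
    ... | yes refl = ≔-same α (σ v) n
    ... | no v≢x   = ≔-other α n (v≢x ∘ σ-injective)
      where
      σ-injective : ∀ {u w} → σ u ≡ σ w → u ≡ w
      σ-injective {u} {w} σu≡σw =
        trans (sym (σ-involutive u)) (trans (cong σ σu≡σw) (σ-involutive w))

    coeffMul-rename : ∀ es {F} → Congruent F → ∀ α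
      → coeffMul (map renameEdge es) F α ≡ coeffMul es (F ∘ (_∘ σ)) (α ∘ σ)
    coeffMul-rename []             F-cong α = F-cong (λ v → cong α (sym (σ-involutive v)))
    coeffMul-rename ((x , y) ∷ es) {F} F-cong α = cong₂ _-_ (lower x) (lower y)
      where
      lower : ∀ z → peel (map renameEdge es) F α (σ z) ≡ peel es (F ∘ (_∘ σ)) (α ∘ σ) z
      lower z with α (σ z)
      ... | zero  = refl
      ... | suc n = trans (coeffMul-rename es F-cong (α [ σ z ≔ n ]))
                             (coeffMul-congruent es (λ β≗γ → F-cong (β≗γ ∘ σ)) (≔-rename α z n))

    -- An involution reversing an odd number of the factors (and permuting the rest) negates
    -- the coefficient, while invariance of α and of the relevant cofactor monomials keeps it.
    coeffMul-odd-symmetry : ∀ Q R {F} → Congruent F → ∀ α q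
      → length Q ≡ suc (2 * q)
      → map renameEdge (Q ++ R) ↭ map Product.swap Q ++ R
      → α ∘ σ ≗ α
      → (∀ β → Reach (Q ++ R) α β → β ∘ σ ≗ β)
      → coeffMul (Q ++ R) F α ≡ 0ℤ
    coeffMul-odd-symmetry Q R {F} F-cong α q odd perm α-inv reach-inv = fixed-by-negation N (begin
      N
        ≡⟨ coeffMul-cong-reach (Q ++ R) α (λ β r → F-cong (λ v → sym (reach-inv β r v))) ⟩
      coeffMul (Q ++ R) (F ∘ (_∘ σ)) α
        ≡⟨ coeffMul-congruent (Q ++ R) (λ β≗γ → F-cong (β≗γ ∘ σ)) α-inv ⟨
      coeffMul (Q ++ R) (F ∘ (_∘ σ)) (α ∘ σ)
        ≡⟨ coeffMul-rename (Q ++ R) F-cong α ⟨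
      coeffMul (map renameEdge (Q ++ R)) F α
        ≡⟨ coeffMul-↭ F-cong perm α ⟩
      coeffMul (map Product.swap Q ++ R) F α
        ≡⟨ coeffMul-reorient Q R F α ⟩
      -1ℤ ℤ.^ length Q ℤ.* N
        ≡⟨ cong (λ m → -1ℤ ℤ.^ m ℤ.* N) odd ⟩
      -1ℤ ℤ.* (-1ℤ ℤ.^ (2 * q)) ℤ.* N
        ≡⟨ cong (λ s → -1ℤ ℤ.* s ℤ.* N) (-1^even q) ⟩
      -1ℤ ℤ.* 1ℤ ℤ.* N
        ≡⟨ ℤ.-1*i≡-i N ⟩
      - N ∎)
      where
      open ≡-Reasoning
      N = coeffMul (Q ++ R) F α

      -1^even : ∀ q → -1ℤ ℤ.^ (2 * q) ≡ 1ℤ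
      -1^even q = trans (sym (ℤ.^-*-assoc -1ℤ 2 q)) (ℤ.^-zeroˡ q)

      fixed-by-negation : ∀ z → z ≡ - z → z ≡ 0ℤ
      fixed-by-negation (ℤ.+ zero)    _  = refl
      fixed-by-negation (ℤ.+ (suc _)) ()
      fixed-by-negation ℤ.-[1+ _ ]    ()

  weight : List V → Exponent → ℕ
  weight W α = sum (map α W)

  EdgeIn : List V → Edge → Set
  EdgeIn W (x , y) = x ∈ W × y ∈ W

  weight-++ : ∀ A B α → weight (A ++ B) α ≡ weight A α + weight B α
  weight-++ A B α = trans (cong sum (map-++ α A B)) (sum-++ (map α A) (map α B))

  weight-mono : ∀ W {α β} → β ≤ₑ α → weight W β ≤ weight W α
  weight-mono []      β≤α = z≤n
  weight-mono (w ∷ W) β≤α = ℕ.+-mono-≤ (β≤α w) (weight-mono W β≤α)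

  weight-∷-< : ∀ v W {α β} → β ≤ₑ α → β v < α v → weight (v ∷ W) β < weight (v ∷ W) α
  weight-∷-< v W β≤α lt = ℕ.+-mono-<-≤ lt (weight-mono W β≤α)

  weight-≔-outside : ∀ W α {x} n → All (_≢ x) W → weight W (α [ x ≔ n ]) ≡ weight W α
  weight-≔-outside []      α n []          = refl
  weight-≔-outside (w ∷ W) α n (w≢x ∷ W≢x) = cong₂ _+_ (≔-other α n w≢x) (weight-≔-outside W α n W≢x)

  weight-lower : ∀ {W} → Unique W → ∀ α {x n} → x ∈ W → α x ≡ suc n
    → suc (weight W (α [ x ≔ n ])) ≡ weight W α
  weight-lower {x ∷ W} (x∉W ∷ _) α {n = n} (here refl) αx = begin
    suc ((α [ x ≔ n ]) x + weight W (α [ x ≔ n ]))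
      ≡⟨ cong₂ (λ a b → suc (a + b)) (≔-same α x n) (weight-≔-outside W α n (All.map (_∘ sym) x∉W)) ⟩
    suc (n + weight W α)
      ≡⟨ cong (_+ weight W α) αx ⟨
    α x + weight W α                               ∎
    where open ≡-Reasoning
  weight-lower {w ∷ W} (w∉W ∷ u) α {n = n} (there x∈W) αx = begin
    suc ((α [ _ ≔ n ]) w + weight W (α [ _ ≔ n ]))
      ≡⟨ cong (λ a → suc (a + _)) (≔-other α n (All.lookup w∉W x∈W)) ⟩
    suc (α w + weight W (α [ _ ≔ n ]))
      ≡⟨ ℕ.+-suc (α w) _ ⟨
    α w + suc (weight W (α [ _ ≔ n ]))
      ≡⟨ cong (α w +_) (weight-lower u α x∈W αx) ⟩
    α w + weight W α                               ∎
    where open ≡-Reasoning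

  reach-weight : ∀ {W} → Unique W → ∀ {es α β} → All (EdgeIn W) es → Reach es α β
    → weight W β + length es ≡ weight W α
  reach-weight u []                done         = ℕ.+-identityʳ _
  reach-weight u ((x∈ , _) ∷ ins) (pickˡ αx r) =
    trans (ℕ.+-suc _ _) (trans (cong suc (reach-weight u ins r)) (weight-lower u _ x∈ αx))
  reach-weight u ((_ , y∈) ∷ ins) (pickʳ αy r) =
    trans (ℕ.+-suc _ _) (trans (cong suc (reach-weight u ins r)) (weight-lower u _ y∈ αy))

  coeffMul-vanishes-light : ∀ {W} → Unique W → ∀ es {F} α → All (EdgeIn W) es
    → weight W α < length es → coeffMul es F α ≡ 0ℤ
  coeffMul-vanishes-light u es α ins light = coeffMul-vanishes es α λ β r →
    ⊥-elim (ℕ.<⇒≱ light (subst (length es ≤_) (reach-weight u ins r) (ℕ.m≤n+m _ _)))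

  weight-zero : ∀ W β → weight W β ≡ 0 → All (λ v → β v ≡ 0) W
  weight-zero []      β _ = []
  weight-zero (w ∷ W) β e = ℕ.m+n≡0⇒m≡0 (β w) e ∷ weight-zero W β (ℕ.m+n≡0⇒n≡0 (β w) e)

  reach-exhausts : ∀ {W} → Unique W → ∀ {es α β} → All (EdgeIn W) es
    → weight W α ≡ length es → Reach es α β → All (λ v → β v ≡ 0) W
  reach-exhausts {W} u {es} ins tight r =
    weight-zero W _ (ℕ.+-cancelʳ-≡ (length es) _ 0 (trans (reach-weight u ins r) tight))

  weight-≤ : ∀ W {α k} → All (λ v → α v ≤ k) W → weight W α ≤ length W * k
  weight-≤ []      []         = z≤n
  weight-≤ (w ∷ W) (αw≤ ∷ α≤) = ℕ.+-mono-≤ αw≤ (weight-≤ W α≤)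

  weight-tight : ∀ W {α k} → All (λ v → α v ≤ k) W → length W * k ≤ weight W α
    → All (λ v → α v ≡ k) W
  weight-tight []      []         _     = []
  weight-tight (w ∷ W) (αw≤ ∷ α≤) tight with +-tight αw≤ (weight-≤ W α≤) tight
  ... | αw≡k , rest≡ = αw≡k ∷ weight-tight W α≤ (ℕ.≤-reflexive (sym rest≡))

open CoefficientCalculus _≟V_

consecutive-All : ∀ {P : Vert → Set} {Q : Edge → Set} → (∀ {x y} → P x → P y → Q (x , y))
  → ∀ {l} → All P l → All Q (consecutive l)
consecutive-All f []                 = []
consecutive-All f (_ ∷ [])           = []
consecutive-All f (px ∷ py ∷ pl)     = f px py ∷ consecutive-All f (py ∷ pl)

length-consecutive : ∀ v l → length (consecutive (v ∷ l)) ≡ length l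
length-consecutive v []      = refl
length-consecutive v (w ∷ l) = cong suc (length-consecutive w l)

map-consecutive : ∀ f l → map (Product.map f f) (consecutive l) ≡ consecutive (map f l)
map-consecutive f []          = refl
map-consecutive f (x ∷ [])    = refl
map-consecutive f (x ∷ y ∷ l) = cong ((f x , f y) ∷_) (map-consecutive f (y ∷ l))

consecutive-∷ʳ : ∀ l y x → consecutive ((l ∷ʳ y) ∷ʳ x) ≡ consecutive (l ∷ʳ y) ∷ʳ (y , x)
consecutive-∷ʳ []          y x = refl
consecutive-∷ʳ (a ∷ [])    y x = refl
consecutive-∷ʳ (a ∷ b ∷ l) y x = cong ((a , b) ∷_) (consecutive-∷ʳ (b ∷ l) y x)

consecutive-reverse : ∀ l → consecutive (reverse l) ≡ reverse (map Product.swap (consecutive l))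
consecutive-reverse []          = refl
consecutive-reverse (a ∷ [])    = refl
consecutive-reverse (a ∷ b ∷ l) = begin
  consecutive (reverse (a ∷ b ∷ l))
    ≡⟨ cong consecutive (unfold-reverse a (b ∷ l)) ⟩
  consecutive (reverse (b ∷ l) ∷ʳ a)
    ≡⟨ cong (λ m → consecutive (m ∷ʳ a)) (unfold-reverse b l) ⟩
  consecutive ((reverse l ∷ʳ b) ∷ʳ a)
    ≡⟨ consecutive-∷ʳ (reverse l) b a ⟩
  consecutive (reverse l ∷ʳ b) ∷ʳ (b , a)
    ≡⟨ cong (λ m → consecutive m ∷ʳ (b , a)) (unfold-reverse b l) ⟨
  consecutive (reverse (b ∷ l)) ∷ʳ (b , a)
    ≡⟨ cong (_∷ʳ (b , a)) (consecutive-reverse (b ∷ l)) ⟩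
  reverse (map Product.swap (consecutive (b ∷ l))) ∷ʳ (b , a)
    ≡⟨ unfold-reverse (b , a) (map Product.swap (consecutive (b ∷ l))) ⟨
  reverse (map Product.swap (consecutive (a ∷ b ∷ l))) ∎
  where open ≡-Reasoning

-- The i-th component, whose path v₂ … v_k has n = k − 3 internal vertices.
module Component (i n : ℕ) where

  internals : List Vert
  internals = applyUpTo (λ j → inner i (suc j)) n

  path : List Vert
  path = spoke (suc i) ∷ internals ++ spoke i ∷ []

  rimEdges : List Edge
  rimEdges = consecutive path

  hubEdge centreEdge : Vert → Edge
  hubEdge v = (hub , v)
  centreEdge v = (center i , v)

  centreEdges : List Edge
  centreEdges = (center i , hub) ∷ map centreEdge path

  ordinaryEdges : List Edge
  ordinaryEdges = rimEdges ++ centreEdges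

  brokenEdges : List Edge
  brokenEdges = rimEdges ++ map hubEdge internals

  brokenVerts : List Vert
  brokenVerts = hub ∷ spoke i ∷ spoke (suc i) ∷ internals

  ordinaryVerts : List Vert
  ordinaryVerts = center i ∷ brokenVerts

  internals-unique : Unique internals
  internals-unique = Unique.applyUpTo⁺₁ _ n (λ j<k _ → λ { refl → ℕ.<-irrefl refl j<k })

  brokenVerts-unique : Unique brokenVerts
  brokenVerts-unique =
    ((λ ()) ∷ (λ ()) ∷ All.applyUpTo⁺₂ _ n (λ _ ())) ∷
    ((λ ()) ∷ All.applyUpTo⁺₂ _ n (λ _ ())) ∷
    All.applyUpTo⁺₂ _ n (λ _ ()) ∷
    internals-unique

  ordinaryVerts-unique : Unique ordinaryVerts
  ordinaryVerts-unique = ((λ ()) ∷ (λ ()) ∷ (λ ()) ∷ All.applyUpTo⁺₂ _ n (λ _ ())) ∷ brokenVerts-unique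

  path⊆brokenVerts : All (_∈ brokenVerts) path
  path⊆brokenVerts =
    there (there (here refl)) ∷ All.++⁺ (All.tabulate (there ∘ there ∘ there)) (there (here refl) ∷ [])

  brokenEdges-within : All (EdgeIn brokenVerts) brokenEdges
  brokenEdges-within = All.++⁺ (consecutive-All _,_ path⊆brokenVerts)
    (All.map⁺ (All.tabulate (λ v∈ → here refl , there (there (there v∈)))))

  ordinaryEdges-within : All (EdgeIn ordinaryVerts) ordinaryEdges
  ordinaryEdges-within = All.++⁺ (consecutive-All _,_ path⊆)
    ((here refl , there (here refl)) ∷ All.map⁺ (All.map (here refl ,_) path⊆))
    where
    path⊆ : All (_∈ ordinaryVerts) path
    path⊆ = All.map there path⊆brokenVerts

  length-internals : length internals ≡ n
  length-internals = length-applyUpTo _ n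

  length-path : length path ≡ suc (suc n)
  length-path = cong suc (begin
    length (internals ++ spoke i ∷ [])  ≡⟨ length-++ internals ⟩
    length internals + 1                ≡⟨ cong (_+ 1) length-internals ⟩
    n + 1                               ≡⟨ ℕ.+-comm n 1 ⟩
    suc n                               ∎)
    where open ≡-Reasoning

  length-rimEdges : length rimEdges ≡ suc n
  length-rimEdges = trans (length-consecutive _ (internals ++ spoke i ∷ [])) (ℕ.suc-injective length-path)

  length-brokenEdges : length brokenEdges ≡ suc (n * 2)
  length-brokenEdges = begin
    length brokenEdges
      ≡⟨ length-++ rimEdges ⟩
    length rimEdges + length (map hubEdge internals)
      ≡⟨ cong₂ _+_ length-rimEdges (trans (length-map hubEdge internals) length-internals) ⟩
    suc n + n
      ≡⟨ solve 1 (λ n → con 1 :+ n :+ n := con 1 :+ n :* con 2) refl n ⟩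
    suc (n * 2)                                        ∎
    where
    open ≡-Reasoning
    open ℕ-Solver.+-*-Solver

  length-ordinaryEdges : length ordinaryEdges ≡ 4 + n * 2
  length-ordinaryEdges = begin
    length ordinaryEdges
      ≡⟨ length-++ rimEdges ⟩
    length rimEdges + suc (length (map centreEdge path))
      ≡⟨ cong₂ (λ a b → a + suc b) length-rimEdges (trans (length-map centreEdge path) length-path) ⟩
    suc n + suc (suc (suc n))
      ≡⟨ solve 1 (λ n → con 1 :+ n :+ (con 3 :+ n) := con 4 :+ n :* con 2) refl n ⟩
    4 + n * 2                                                ∎
    where
    open ≡-Reasoning
    open ℕ-Solver.+-*-Solver

  -- The reflection of the component exchanging v₂ and v_k and reversing the path between them.
  mirror : Vert → Vert
  mirror hub               = hub
  mirror (center a)        = center a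
  mirror (inner a zero)    = inner a zero
  mirror (inner a (suc j)) with a ℕ.≟ i | j <? n
  ... | yes _ | yes _ = inner a (suc (n ∸ suc j))
  ... | _     | _     = inner a (suc j)
  mirror (spoke j) with j ℕ.≟ i | j ℕ.≟ suc i
  ... | yes _ | _     = spoke (suc i)
  ... | no  _ | yes _ = spoke i
  ... | no  _ | no  _ = spoke j

  mirror-spoke : mirror (spoke i) ≡ spoke (suc i)
  mirror-spoke with i ℕ.≟ i
  ... | yes _   = refl
  ... | no  i≢i = ⊥-elim (i≢i refl)

  mirror-spoke-suc : mirror (spoke (suc i)) ≡ spoke i
  mirror-spoke-suc with suc i ℕ.≟ i | suc i ℕ.≟ suc i
  ... | yes 1+i≡i | _         = ⊥-elim (ℕ.1+n≢n 1+i≡i)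
  ... | no  _     | yes _     = refl
  ... | no  _     | no  ≢1+i  = ⊥-elim (≢1+i refl)

  mirror-fixes-spoke : ∀ {j} → j ≢ i → j ≢ suc i → mirror (spoke j) ≡ spoke j
  mirror-fixes-spoke {j} j≢i j≢1+i with j ℕ.≟ i | j ℕ.≟ suc i
  ... | yes j≡i | _         = ⊥-elim (j≢i j≡i)
  ... | no  _   | yes j≡1+i = ⊥-elim (j≢1+i j≡1+i)
  ... | no  _   | no  _     = refl

  mirror-internal : ∀ {j} → j < n → mirror (inner i (suc j)) ≡ inner i (suc (n ∸ suc j))
  mirror-internal {j} j<n with i ℕ.≟ i | j <? n
  ... | yes _   | yes _   = refl
  ... | no  i≢i | _       = ⊥-elim (i≢i refl)
  ... | yes _   | no  j≮n = ⊥-elim (j≮n j<n)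

  mirror-fixes-inner : ∀ a j → ¬ (a ≡ i × j < n) → mirror (inner a (suc j)) ≡ inner a (suc j)
  mirror-fixes-inner a j outside with a ℕ.≟ i | j <? n
  ... | yes a≡i | yes j<n = ⊥-elim (outside (a≡i , j<n))
  ... | yes _   | no  _   = refl
  ... | no  _   | _       = refl

  mirror-involutive : ∀ v → mirror (mirror v) ≡ v
  mirror-involutive hub            = refl
  mirror-involutive (center a)     = refl
  mirror-involutive (inner a zero) = refl
  mirror-involutive (inner a (suc j)) with a ℕ.≟ i | j <? n
  ... | yes refl | yes j<n =
    trans (mirror-internal (∸-suc-< j<n)) (cong (inner i ∘ suc) (∸-suc-involutive j<n))
  ... | yes refl | no  j≮n = mirror-fixes-inner i j (j≮n ∘ Product.proj₂)
  ... | no  a≢i  | _       = mirror-fixes-inner a j (a≢i ∘ Product.proj₁)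
  mirror-involutive (spoke j) with j ℕ.≟ i | j ℕ.≟ suc i
  ... | yes refl | _        = mirror-spoke-suc
  ... | no  _    | yes refl = mirror-spoke
  ... | no  j≢i  | no j≢1+i = mirror-fixes-spoke j≢i j≢1+i

  mirror-invariant : ∀ (β : Exponent) K → β (spoke i) ≡ β (spoke (suc i)) → All (λ v → β v ≡ K) internals
    → β ∘ mirror ≗ β
  mirror-invariant β K βs βint hub            = refl
  mirror-invariant β K βs βint (center a)     = refl
  mirror-invariant β K βs βint (inner a zero) = refl
  mirror-invariant β K βs βint (inner a (suc j)) with a ℕ.≟ i | j <? n
  ... | yes refl | yes j<n =
    trans (All.applyUpTo⁻ _ n βint (∸-suc-< j<n)) (sym (All.applyUpTo⁻ _ n βint j<n))
  ... | yes refl | no  _   = refl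
  ... | no  _    | _       = refl
  mirror-invariant β K βs βint (spoke j) with j ℕ.≟ i | j ℕ.≟ suc i
  ... | yes refl | _        = sym βs
  ... | no  _    | yes refl = βs
  ... | no  _    | no  _    = refl

  mirror-internals : map mirror internals ≡ reverse internals
  mirror-internals = begin
    map mirror internals                              ≡⟨ map-applyUpTo _ mirror n ⟩
    applyUpTo (λ j → mirror (inner i (suc j))) n      ≡⟨ applyUpTo-cong n mirror-internal ⟩
    applyUpTo (λ j → inner i (suc (n ∸ suc j))) n     ≡⟨ applyUpTo-reflect (λ j → inner i (suc j)) n ⟩
    applyDownFrom (λ j → inner i (suc j)) n           ≡⟨ reverse-applyUpTo _ n ⟨
    reverse internals                                 ∎
    where open ≡-Reasoning

  mirror-path : map mirror path ≡ reverse path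
  mirror-path = begin
    mirror (spoke (suc i)) ∷ map mirror (internals ++ spoke i ∷ [])
      ≡⟨ cong₂ _∷_ mirror-spoke-suc (map-++ mirror internals _) ⟩
    spoke i ∷ (map mirror internals ++ mirror (spoke i) ∷ [])
      ≡⟨ cong₂ (λ l v → spoke i ∷ (l ++ v ∷ [])) mirror-internals mirror-spoke ⟩
    spoke i ∷ (reverse internals ++ spoke (suc i) ∷ [])
      ≡⟨ cong (_∷ʳ spoke (suc i)) (reverse-++ internals (spoke i ∷ [])) ⟨
    reverse (internals ++ spoke i ∷ []) ∷ʳ spoke (suc i)
      ≡⟨ unfold-reverse (spoke (suc i)) (internals ++ spoke i ∷ []) ⟨
    reverse path ∎
    where open ≡-Reasoning

  open Renaming mirror mirror-involutive

  mirror-ordinaryEdges : map renameEdge ordinaryEdges ↭ map Product.swap rimEdges ++ centreEdges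
  mirror-ordinaryEdges = subst (_↭ map Product.swap rimEdges ++ centreEdges) (sym mirrored)
    (↭.++⁺ (↭.↭-reverse _) (prep _ (↭.map⁺ centreEdge (↭.↭-reverse path))))
    where
    open ≡-Reasoning
    mirrored : map renameEdge ordinaryEdges
             ≡ reverse (map Product.swap rimEdges) ++ (center i , hub) ∷ map centreEdge (reverse path)
    mirrored = begin
      map renameEdge (rimEdges ++ centreEdges)
        ≡⟨ map-++ renameEdge rimEdges centreEdges ⟩
      map renameEdge rimEdges ++ (center i , hub) ∷ map renameEdge (map centreEdge path)
        ≡⟨ cong₂ (λ l m → l ++ (center i , hub) ∷ m) (map-consecutive mirror path)
                 (trans (sym (map-∘ path)) (map-∘ path)) ⟩
      consecutive (map mirror path) ++ (center i , hub) ∷ map centreEdge (map mirror path)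
        ≡⟨ cong (λ l → consecutive l ++ (center i , hub) ∷ map centreEdge l) mirror-path ⟩
      consecutive (reverse path) ++ (center i , hub) ∷ map centreEdge (reverse path)
        ≡⟨ cong (_++ (center i , hub) ∷ map centreEdge (reverse path)) (consecutive-reverse path) ⟩
      reverse (map Product.swap rimEdges) ++ (center i , hub) ∷ map centreEdge (reverse path) ∎

  broken-vanishes : ∀ {F} α → α hub ≡ 0 → α (spoke i) ≡ 0 → α (spoke (suc i)) ≡ 0
    → All (λ v → α v ≤ 2) internals → coeffMul brokenEdges F α ≡ 0ℤ
  broken-vanishes α hub0 s0 s'0 int≤2 =
    coeffMul-vanishes-light brokenVerts-unique brokenEdges α brokenEdges-within (begin-strict
      weight brokenVerts α    ≡⟨ weight≡ ⟩
      weight internals α      ≤⟨ weight-≤ internals int≤2 ⟩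
      length internals * 2    ≡⟨ cong (_* 2) length-internals ⟩
      n * 2                   <⟨ ℕ.n<1+n _ ⟩
      suc (n * 2)             ≡⟨ length-brokenEdges ⟨
      length brokenEdges      ∎)
    where
    open ℕ.≤-Reasoning
    weight≡ : weight brokenVerts α ≡ weight internals α
    weight≡ rewrite hub0 | s0 | s'0 = refl

  -- Either the degree is too small for the edges, or every vertex is saturated; then α is
  -- mirror-symmetric while the mirror reverses the n + 1 = k − 2 rim edges, an odd number.
  ordinary-vanishes : ∀ q → n ≡ 2 * q → ∀ {F} → Congruent F → ∀ α
    → α hub ≡ 0 → α (spoke i) ≡ 0 → α (spoke (suc i)) ≡ 0
    → α (center i) ≤ 4 → All (λ v → α v ≤ 2) internals
    → coeffMul ordinaryEdges F α ≡ 0ℤ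
  ordinary-vanishes q n≡2q F-cong α hub0 s0 s'0 c≤4 int≤2 = by-weight (ℕ.m≤n⇒m<n∨m≡n bounded)
    where
    weight≡ : weight ordinaryVerts α ≡ α (center i) + weight internals α
    weight≡ rewrite hub0 | s0 | s'0 = refl

    capacity : 4 + length internals * 2 ≡ length ordinaryEdges
    capacity = trans (cong (λ m → 4 + m * 2) length-internals) (sym length-ordinaryEdges)

    bounded : weight ordinaryVerts α ≤ length ordinaryEdges
    bounded = subst₂ _≤_ (sym weight≡) capacity (ℕ.+-mono-≤ c≤4 (weight-≤ internals int≤2))

    by-weight : weight ordinaryVerts α < length ordinaryEdges ⊎ weight ordinaryVerts α ≡ length ordinaryEdges
      → coeffMul ordinaryEdges _ α ≡ 0ℤ
    by-weight (inj₁ light) =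
      coeffMul-vanishes-light ordinaryVerts-unique ordinaryEdges α ordinaryEdges-within light
    by-weight (inj₂ tight) = coeffMul-odd-symmetry rimEdges centreEdges F-cong α q
      (trans length-rimEdges (cong suc n≡2q)) mirror-ordinaryEdges α-invariant reach-invariant
      where
      internals-full : weight internals α ≡ length internals * 2
      internals-full = Product.proj₂ (+-tight c≤4 (weight-≤ internals int≤2)
        (ℕ.≤-reflexive (trans capacity (trans (sym tight) weight≡))))

      α-invariant : α ∘ mirror ≗ α
      α-invariant = mirror-invariant α 2 (trans s0 (sym s'0))
        (weight-tight internals int≤2 (ℕ.≤-reflexive (sym internals-full)))

      reach-invariant : ∀ β → Reach ordinaryEdges α β → β ∘ mirror ≗ β
      reach-invariant β r with reach-exhausts ordinaryVerts-unique ordinaryEdges-within tight r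
      ... | _ ∷ _ ∷ βs ∷ βs' ∷ βint = mirror-invariant β 0 (trans βs (sym βs')) βint

sameEdge-false : ∀ {e f} → e ≢ f → e ≢ Product.swap f → sameEdge e f ≡ false
sameEdge-false {a , b} {c , d} e≢f e≢f' with a ≟V c | b ≟V d | a ≟V d | b ≟V c
... | yes refl | yes refl | _        | _        = ⊥-elim (e≢f refl)
... | _        | _        | yes refl | yes refl = ⊥-elim (e≢f' refl)
... | no  _    | _        | no  _    | _        = refl
... | no  _    | _        | yes _    | no  _    = refl
... | yes _    | no  _    | no  _    | _        = refl
... | yes _    | no  _    | yes _    | no  _    = refl

sameEdge-refl : ∀ e → sameEdge e e ≡ true
sameEdge-refl (a , b) rewrite dec-true (a ≟V a) refl | dec-true (b ≟V b) refl = refl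

Kept : List Edge → Edge → Set
Kept ps e = T (not (any (sameEdge e) ps))

kept : ∀ e {ps} → All (λ f → e ≢ f × e ≢ Product.swap f) ps → Kept ps e
kept e []                     = tt
kept e ((e≢f , e≢f') ∷ rest) rewrite sameEdge-false e≢f e≢f' = kept e rest

deleted : ∀ e {f ps} → f ∈ ps → sameEdge e f ≡ true → ¬ Kept ps e
deleted e (here refl) same rewrite same = λ ()
deleted e {ps = g ∷ ps} (there f∈) same with sameEdge e g
... | true  = λ ()
... | false = deleted e f∈ same

NotHubSpoke : Edge → Set
NotHubSpoke e = ∀ j → e ≢ (hub , spoke j) × e ≢ (spoke j , hub)

rim-notHubSpoke : ∀ i c → All NotHubSpoke (consecutive (pathVerts i c))
rim-notHubSpoke i c = consecutive-All {P = _≢ hub}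
  (λ x≢hub y≢hub j → (x≢hub ∘ cong Product.proj₁) , (y≢hub ∘ cong Product.proj₂))
  ((λ ()) ∷ All.++⁺ (All.applyUpTo⁺₂ _ _ (λ _ ())) ((λ ()) ∷ []))

compEdges-notHubSpoke : ∀ i c → All NotHubSpoke (compEdges i c)
compEdges-notHubSpoke i (comp ordinary k) = All.++⁺ (rim-notHubSpoke i (comp ordinary k))
  ((λ j → (λ ()) , (λ ())) ∷ All.map⁺ (All.tabulate (λ _ j → (λ ()) , (λ ()))))
compEdges-notHubSpoke i (comp broken k) = All.++⁺ (rim-notHubSpoke i (comp broken k))
  (All.map⁺ (All.applyUpTo⁺₂ _ _ (λ _ j → (λ ()) , (λ ()))))

allCompEdges-notHubSpoke : ∀ i cs → All NotHubSpoke (allCompEdges i cs)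
allCompEdges-notHubSpoke i []       = []
allCompEdges-notHubSpoke i (c ∷ cs) = All.++⁺ (compEdges-notHubSpoke i c) (allCompEdges-notHubSpoke (suc i) cs)

interiorSpokes : ℕ → List Edge
interiorSpokes t = applyUpTo (λ j → (hub , spoke (suc j))) t

deleteEdges-principal : ∀ c cs
  → mwEdgesMinusPrincipal (c ∷ cs) ≡ interiorSpokes (length cs) ++ allCompEdges 0 (c ∷ cs)
deleteEdges-principal c cs = begin
  filter keep? (applyUpTo (λ j → (hub , spoke j)) (suc (suc t)) ++ components)
    ≡⟨ filter-++ keep? (applyUpTo (λ j → (hub , spoke j)) (suc (suc t))) components ⟩
  filter keep? ((hub , spoke 0) ∷ applyUpTo (λ j → (hub , spoke (suc j))) (suc t)) ++ filter keep? components
    ≡⟨ cong₂ _++_ (filter-reject keep? {x = hub , spoke 0} {xs = applyUpTo (λ j → (hub , spoke (suc j))) (suc t)}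
                                 first-deleted)
                  (filter-all keep? components-kept) ⟩
  filter keep? (applyUpTo (λ j → (hub , spoke (suc j))) (suc t)) ++ components
    ≡⟨ cong (λ l → filter keep? l ++ components) (applyUpTo-∷ʳ (λ j → (hub , spoke (suc j))) t) ⟨
  filter keep? (interiorSpokes t ∷ʳ (hub , spoke (suc t))) ++ components
    ≡⟨ cong (_++ components) (filter-++ keep? (interiorSpokes t) _) ⟩
  (filter keep? (interiorSpokes t) ++ filter keep? ((hub , spoke (suc t)) ∷ [])) ++ components
    ≡⟨ cong (_++ components) (cong₂ _++_ (filter-all keep? interior-kept)
                                          (filter-reject keep? {x = hub , spoke (suc t)} {xs = []} last-deleted)) ⟩
  (interiorSpokes t ++ []) ++ components
    ≡⟨ cong (_++ components) (++-identityʳ (interiorSpokes t)) ⟩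
  interiorSpokes t ++ components ∎
  where
  open ≡-Reasoning
  t = length cs
  components = allCompEdges 0 (c ∷ cs)
  ps = principalEdges (c ∷ cs)
  keep? = λ e → T? (not (any (sameEdge e) ps))

  first-deleted : ¬ Kept ps (hub , spoke 0)
  first-deleted = deleted (hub , spoke 0) {ps = ps} (here refl) refl

  last-deleted : ¬ Kept ps (hub , spoke (suc t))
  last-deleted = deleted (hub , spoke (suc t)) {ps = ps} (there (here refl)) (sameEdge-refl (hub , spoke (suc t)))

  components-kept : All (Kept ps) components
  components-kept = All.map (λ {e} h → kept e {ps} ((Product.proj₂ (h 0) , Product.proj₁ (h 0)) ∷ h (suc t) ∷ []))
    (allCompEdges-notHubSpoke 0 (c ∷ cs))

  interior-kept : All (Kept ps) (interiorSpokes t)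
  interior-kept = All.applyUpTo⁺₁ (λ j → (hub , spoke (suc j))) t (λ {j} j<t →
    kept (hub , spoke (suc j)) {ps} (((λ ()) , (λ ())) ∷ ((λ { refl → ℕ.<-irrefl refl j<t }) , (λ ())) ∷ []))

WithinCaps : ℕ → List Comp → Exponent → Set
WithinCaps i cs α = (∀ v → v ∈ allInternal i cs → α v ≤ 2) × (∀ u → u ∈ allCenters i cs → α u ≤ 4)

WithinCaps-≤ : ∀ {i cs α β} → β ≤ₑ α → WithinCaps i cs α → WithinCaps i cs β
WithinCaps-≤ β≤α (int≤2 , ctr≤4) =
  (λ v v∈ → ℕ.≤-trans (β≤α v) (int≤2 v v∈)) , (λ u u∈ → ℕ.≤-trans (β≤α u) (ctr≤4 u u∈))

WithinCaps-tail : ∀ {i} c {cs α} → WithinCaps i (c ∷ cs) α → WithinCaps (suc i) cs α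
WithinCaps-tail {i} c {cs} (int≤2 , ctr≤4) =
  (λ v v∈ → int≤2 v (∈-++⁺ʳ (internalVerts i c) v∈)) , (λ u u∈ → ctr≤4 u (centers-tail c u∈))
  where
  centers-tail : ∀ c {u} → u ∈ allCenters (suc i) cs → u ∈ allCenters i (c ∷ cs)
  centers-tail (comp ordinary _) = there
  centers-tail (comp broken _)   = id

component-vanishes : ∀ i c {cs} → ¬ IsEvenWheel c → ∀ {F} → Congruent F → ∀ α
  → α hub ≡ 0 → α (spoke i) ≡ 0 → α (spoke (suc i)) ≡ 0 → WithinCaps i (c ∷ cs) α
  → coeffMul (compEdges i c) F α ≡ 0ℤ
component-vanishes i (comp ordinary k) 2∤k F-cong α hub0 s0 s'0 (int≤2 , ctr≤4)
  with odd⇒∸3-even k 2∤k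
... | q , k∸3≡2q = Component.ordinary-vanishes i (k ∸ 3) q k∸3≡2q F-cong α hub0 s0 s'0
  (ctr≤4 _ (here refl)) (All.tabulate (λ v∈ → int≤2 _ (∈-++⁺ˡ v∈)))
component-vanishes i (comp broken k) _ F-cong α hub0 s0 s'0 (int≤2 , _) =
  Component.broken-vanishes i (k ∸ 3) α hub0 s0 s'0 (All.tabulate (λ v∈ → int≤2 _ (∈-++⁺ˡ v∈)))

spokes : ℕ → ℕ → List Vert
spokes i zero    = spoke i ∷ []
spokes i (suc r) = spoke i ∷ spokes (suc i) r

weight-spokes-< : ∀ i r {α β} → β ≤ₑ α → β (spoke i) < α (spoke i)
  → weight (spokes i r) β < weight (spokes i r) α
weight-spokes-< i zero    = weight-∷-< (spoke i) []
weight-spokes-< i (suc r) = weight-∷-< (spoke i) (spokes (suc i) r)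

spokes-budget : ∀ i r {α β} → β ≤ₑ α → β (spoke i) < α (spoke i) ⊎ β (spoke (suc i)) < α (spoke (suc i))
  → weight (spokes i (suc r)) α < suc r → weight (spokes (suc i) r) β < r
spokes-budget i r {α} {β} β≤α (inj₁ lt) light = begin-strict
  weight (spokes (suc i) r) β          ≤⟨ weight-mono (spokes (suc i) r) β≤α ⟩
  weight (spokes (suc i) r) α          <⟨ ℕ.+-monoˡ-≤ _ (ℕ.≤-trans (s≤s z≤n) lt) ⟩
  weight (spokes i (suc r)) α          ≤⟨ ℕ.≤-pred light ⟩
  r                                    ∎
  where open ℕ.≤-Reasoning
spokes-budget i r {α} {β} β≤α (inj₂ lt) light = begin-strict
  weight (spokes (suc i) r) β          <⟨ weight-spokes-< (suc i) r β≤α lt ⟩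
  weight (spokes (suc i) r) α          ≤⟨ ℕ.m≤n+m _ (α (spoke i)) ⟩
  weight (spokes i (suc r)) α          ≤⟨ ℕ.≤-pred light ⟩
  r                                    ∎
  where open ℕ.≤-Reasoning

components-vanish : ∀ cs i {F} → Congruent F → All (λ c → ¬ IsEvenWheel c) cs → ∀ α → α hub ≡ 0
  → weight (spokes i (length cs)) α < length cs → WithinCaps i cs α
  → coeffMul (allCompEdges i cs) F α ≡ 0ℤ
components-vanish []       i F-cong []               α hub0 () caps
components-vanish (c ∷ cs) i {F} F-cong (2∤c ∷ 2∤cs) α hub0 light caps = trans
  (coeffMul-++ (compEdges i c) (allCompEdges (suc i) cs) F α)
  (coeffMul-vanishes-frozen (compEdges i c) (coeffMul-congruent (allCompEdges (suc i) cs) F-cong)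
    α (λ ()) rest-vanishes
    (λ G-cong → component-vanishes i c {cs} 2∤c G-cong α₂ hub₂ spoke₂ spoke-suc₂
                  (WithinCaps-≤ {i} {c ∷ cs} α₂≤α caps)))
  where
  α₁ α₂ : Exponent
  α₁ = α [ spoke i ≔ 0 ]
  α₂ = α₁ [ spoke (suc i) ≔ 0 ]

  α₂≤α : α₂ ≤ₑ α
  α₂≤α v = ℕ.≤-trans (≔-0-≤ α₁ (spoke (suc i)) v) (≔-0-≤ α (spoke i) v)

  hub₂ : α₂ hub ≡ 0
  hub₂ = ℕ.n≤0⇒n≡0 (subst (α₂ hub ≤_) hub0 (α₂≤α hub))

  spoke₂ : α₂ (spoke i) ≡ 0
  spoke₂ = trans (≔-other α₁ {spoke (suc i)} 0 (λ ())) (≔-same α (spoke i) 0)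

  spoke-suc₂ : α₂ (spoke (suc i)) ≡ 0
  spoke-suc₂ = ≔-same α₁ (spoke (suc i)) 0

  rest-vanishes : ∀ β → β ≤ₑ α → β (spoke i) < α (spoke i) ⊎ β (spoke (suc i)) < α (spoke (suc i))
    → coeffMul (allCompEdges (suc i) cs) F β ≡ 0ℤ
  rest-vanishes β β≤α lowered = components-vanish cs (suc i) F-cong 2∤cs β
    (ℕ.n≤0⇒n≡0 (subst (β hub ≤_) hub0 (β≤α hub)))
    (spokes-budget i (length cs) β≤α lowered light)
    (WithinCaps-≤ {suc i} {cs} β≤α (WithinCaps-tail c caps))

spokes-applyUpTo : ∀ i r → spokes i r ≡ applyUpTo (λ j → spoke (i + j)) (suc r)
spokes-applyUpTo i zero    = cong (λ m → spoke m ∷ []) (sym (ℕ.+-identityʳ i))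
spokes-applyUpTo i (suc r) = cong₂ _∷_ (cong spoke (sym (ℕ.+-identityʳ i)))
  (trans (spokes-applyUpTo (suc i) r) (applyUpTo-cong (suc r) (λ {j} _ → cong spoke (sym (ℕ.+-suc i j)))))

middleSpokes : ℕ → List Vert
middleSpokes t = applyUpTo (λ j → spoke (suc j)) t

spokes-split : ∀ t → spokes 0 (suc t) ≡ spoke 0 ∷ middleSpokes t ∷ʳ spoke (suc t)
spokes-split t = trans (spokes-applyUpTo 0 (suc t))
  (cong (spoke 0 ∷_) (sym (applyUpTo-∷ʳ (λ j → spoke (suc j)) t)))

interiorSpokes-light : ∀ t {α β} → α hub ≡ 0 → α (spoke 0) ≡ 0 → α (spoke (suc t)) ≡ 0
  → All (λ v → α v ≤ 2) (middleSpokes t) → Reach (interiorSpokes t) α β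
  → weight (spokes 0 (suc t)) β < suc t
interiorSpokes-light t {α} {β} hub0 first0 last0 mid≤2 r = s≤s (ℕ.+-cancelʳ-≤ t _ t (begin
  weight (spokes 0 (suc t)) β + t  ≡⟨ cong (_+ t) spokes≡middle ⟩
  weight (middleSpokes t) β + t    ≤⟨ ℕ.+-monoˡ-≤ t (ℕ.m≤n+m _ (β hub)) ⟩
  weight W β + t                   ≡⟨ counted ⟩
  weight W α                       ≡⟨ cong (_+ weight (middleSpokes t) α) hub0 ⟩
  weight (middleSpokes t) α        ≤⟨ weight-≤ (middleSpokes t) mid≤2 ⟩
  length (middleSpokes t) * 2      ≡⟨ cong (_* 2) (length-applyUpTo _ t) ⟩
  t * 2                            ≡⟨ ℕ.*-comm t 2 ⟩
  t + (t + 0)                      ≡⟨ cong (t +_) (ℕ.+-identityʳ t) ⟩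
  t + t                            ∎))
  where
  open ℕ.≤-Reasoning
  W : List Vert
  W = hub ∷ middleSpokes t

  W-unique : Unique W
  W-unique = All.applyUpTo⁺₂ _ t (λ _ ())
           ∷ Unique.applyUpTo⁺₁ _ t (λ j<k _ → λ { refl → ℕ.<-irrefl refl j<k })

  W-edges : All (EdgeIn W) (interiorSpokes t)
  W-edges = All.applyUpTo⁺₁ _ t (λ j<t → here refl , there (∈-applyUpTo⁺ (λ j → spoke (suc j)) j<t))

  counted : weight W β + t ≡ weight W α
  counted = subst (λ m → weight W β + m ≡ weight W α) (length-applyUpTo _ t) (reach-weight W-unique W-edges r)

  stays-zero : ∀ {v} → α v ≡ 0 → β v ≡ 0
  stays-zero {v} αv≡0 = ℕ.n≤0⇒n≡0 (subst (β v ≤_) αv≡0 (reach-≤ r v))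

  spokes≡middle : weight (spokes 0 (suc t)) β ≡ weight (middleSpokes t) β
  spokes≡middle = begin-equality
    weight (spokes 0 (suc t)) β
      ≡⟨ cong (λ l → weight l β) (spokes-split t) ⟩
    β (spoke 0) + weight (middleSpokes t ++ spoke (suc t) ∷ []) β
      ≡⟨ cong₂ _+_ (stays-zero first0) (weight-++ (middleSpokes t) _ β) ⟩
    weight (middleSpokes t) β + (β (spoke (suc t)) + 0)
      ≡⟨ cong (λ m → weight (middleSpokes t) β + (m + 0)) (stays-zero last0) ⟩
    weight (middleSpokes t) β + 0
      ≡⟨ ℕ.+-identityʳ _ ⟩
    weight (middleSpokes t) β                                     ∎

corollary5p10 : (cs : List Comp)
    → 2 ≤ length cs
    → All (λ c → 3 ≤ size c) cs
    → Any IsOrdinary cs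
    → All (λ c → ¬ IsEvenWheel c) cs
    → (α : Vert → ℕ)
    → α hub ≡ 0
    → α (principalV2 cs) ≡ 0
    → α (principalVk cs) ≡ 0
    → (∀ v → v ∈ outerRest cs → α v ≤ 2)
    → (∀ u → u ∈ innerVerts cs → α u ≤ 4)
    → Vanishes (mwVertices cs) (mwEdgesMinusPrincipal cs) α
corollary5p10 [] ()
corollary5p10 (c ∷ cs) _ _ _ 2∤cs α hub0 v₂0 vₖ0 outer≤2 inner≤4 = begin
  coeff vs (mwEdgesMinusPrincipal (c ∷ cs)) α
    ≡⟨ coeff≡coeffMul vs (mwEdgesMinusPrincipal (c ∷ cs)) α ⟩
  coeffMul (mwEdgesMinusPrincipal (c ∷ cs)) F α
    ≡⟨ cong (λ es → coeffMul es F α) (deleteEdges-principal c cs) ⟩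
  coeffMul (interiorSpokes t ++ components) F α
    ≡⟨ coeffMul-++ (interiorSpokes t) components F α ⟩
  coeffMul (interiorSpokes t) (coeffMul components F) α
    ≡⟨ coeffMul-vanishes (interiorSpokes t) α components-vanish-below ⟩
  0ℤ                                                    ∎
  where
  open ≡-Reasoning
  vs = mwVertices (c ∷ cs)
  F = coeffOne vs
  t = length cs
  components = allCompEdges 0 (c ∷ cs)

  components-vanish-below : ∀ β → Reach (interiorSpokes t) α β → coeffMul components F β ≡ 0ℤ
  components-vanish-below β r = components-vanish (c ∷ cs) 0 (coeffOne-congruent vs) 2∤cs β
    (ℕ.n≤0⇒n≡0 (subst (β hub ≤_) hub0 (reach-≤ r hub)))
    (interiorSpokes-light t hub0 vₖ0 v₂0
      (All.applyUpTo⁺₁ _ t (λ j<t → outer≤2 _ (∈-++⁺ˡ (∈-applyUpTo⁺ (λ j → spoke (suc j)) j<t)))) r)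
    (WithinCaps-≤ {0} {c ∷ cs} (reach-≤ r)
      ((λ v v∈ → outer≤2 v (∈-++⁺ʳ (middleSpokes t) v∈)) , inner≤4))
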